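{- Let $D=(V,E)$ be a directed graph with countably infinite vertex set. The following are equivalent: (1) For every subset $V_1\subseteq V$ such that both $V_1$ and $V\setminus V_1$ are infinite, there exists a nonempty $W_1\subseteq V_1$ such that every $v\in W_1$ has infinite out-degree in the induced subgraph $D[W_1]$. (2) For every labeling of $V$ by $\mathbb{Z}$ there is an infinite increasing directed path in $D$.
   Context: An edge $(u,v)\in E$ is oriented from $u$ to $v$. A labeling of $V$ by $\mathbb{Z}$ is a bijection $\phi:V\to\mathbb{Z}$. An infinite increasing directed path is a sequence of distinct vertices $v_1,v_2,\dots$ with $(v_i,v_{i+1})\in E$ and $\phi(v_i)<\phi(v_{i+1})$ for all $i\ge1$. -}

module Defs where

open import Level using (0ℓ)
open import Data.Nat using (ℕ; suc)
open import Data.Integer using (ℤ; _<_)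
open import Data.List using (List)
open import Data.List.Membership.Propositional using (_∈_)
open import Data.Product using (Σ; ∃; _×_)
open import Relation.Nullary using (¬_)
open import Relation.Unary using (Pred; _⊆_)
open import Function.Bundles using (_⤖_; Bijection)
open import Function.Definitions using (Injective)
open import Relation.Binary.PropositionalEquality using (_≡_)

record Digraph : Set₁ where
  field
    V : Set
    E : V → V → Set

CountablyInfinite : Set → Set
CountablyInfinite A = A ⤖ ℕ

Finite : {A : Set} → Pred A 0ℓ → Set
Finite {A} S = Σ (List A) λ xs → ∀ a → S a → a ∈ xs

Infinite : {A : Set} → Pred A 0ℓ → Set
Infinite S = ¬ Finite S

Compl : {A : Set} → Pred A 0ℓ → Pred A 0ℓ
Compl S a = ¬ S a

Nonempty : {A : Set} → Pred A 0ℓ → Set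
Nonempty S = ∃ λ a → S a

module _ (D : Digraph) where
  open Digraph D

  OutNbrsIn : Pred V 0ℓ → V → Pred V 0ℓ
  OutNbrsIn W v u = W u × E v u

  InfiniteOutDegreeIn : Pred V 0ℓ → V → Set
  InfiniteOutDegreeIn W v = Infinite (OutNbrsIn W v)

  Condition1 : Set₁
  Condition1 = (V₁ : Pred V 0ℓ) → Infinite V₁ → Infinite (Compl V₁) →
    Σ (Pred V 0ℓ) λ W₁ → W₁ ⊆ V₁ × Nonempty W₁ ×
      (∀ v → W₁ v → InfiniteOutDegreeIn W₁ v)

  Labeling : Set
  Labeling = V ⤖ ℤ

  IsInfIncPath : Labeling → (ℕ → V) → Set
  IsInfIncPath φ p = Injective _≡_ _≡_ p ×
    (∀ i → E (p i) (p (suc i)) ×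
           Bijection.to φ (p i) < Bijection.to φ (p (suc i)))

  HasInfIncPath : Labeling → Set
  HasInfIncPath φ = Σ (ℕ → V) (IsInfIncPath φ)

  Condition2 : Set
  Condition2 = (φ : Labeling) → HasInfIncPath φ

module Submission where

open import Defs
open import Level using (0ℓ)
open import Axiom.ExcludedMiddle using (ExcludedMiddle)
open import Data.Empty using (⊥-elim)
open import Data.Product using (Σ; ∃; _×_; _,_; proj₁; proj₂)
open import Data.Sum using (_⊎_; inj₁; inj₂)
open import Data.Nat as ℕ using (ℕ; zero; suc; s≤s; _≤′_; ≤′-refl; ≤′-step)
import Data.Nat.Properties as ℕP
open import Data.Integer as ℤ using (ℤ; +_; -[1+_]; 0ℤ; _≤_; _<_; +≤+; -≤+; -≤-; +<+)
import Data.Integer.Properties as ℤP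
open import Data.List using (List; []; _∷_; _++_; map; upTo)
open import Data.List.Extrema.Nat using (max; xs≤max)
open import Data.List.Membership.Propositional using (_∈_; _∉_)
open import Data.List.Membership.Propositional.Properties using (∈-map⁺; ∈-upTo⁺; ∈-++⁺ˡ; ∈-++⁺ʳ)
open import Data.List.Relation.Unary.All using (lookup)
open import Data.List.Relation.Unary.Any using (here; there)
open import Data.List.Relation.Binary.Subset.Propositional using (_⊆_)
open import Data.List.Relation.Binary.Subset.Propositional.Properties using (xs⊆ys++xs)
open import Function using (_∘_)
open import Function.Bundles using (_⤖_; Bijection; Inverse; mk⤖)
open import Function.Consequences.Propositional using (strictlySurjective⇒surjective)
open import Function.Definitions using (Injective)
open import Function.Properties.Bijection using (⤖⇒↔)
open import Function.Properties.Inverse using (↔⇒⤖; ↔-sym)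
open import Relation.Binary.Definitions using (tri<; tri≈; tri>)
open import Relation.Binary.PropositionalEquality using (_≡_; refl; sym; trans; cong; subst; subst₂)
open import Relation.Nullary using (¬_; yes; no)
open import Relation.Unary using (Pred; _∖_)

-- (1) ⇒ (2).  Given a labelling φ, apply (1) to the vertices with nonnegative
-- label.  In the resulting set W every vertex has infinitely many out-neighbours
-- in W, while only finitely many vertices have labels in [0, φ w]; so from every
-- w ∈ W an edge leads to a vertex of W with a larger label, and iterating gives
-- an infinite increasing path.
--
-- (2) ⇒ (1).  Fix V₁.  Either some finite R leaves V₁ ∖ R with every vertex of
-- infinite out-degree inside it (and V₁ ∖ R is the required W₁), or V₁ is
-- sparse: V₁ ∖ R always contains a vertex of finite out-degree into V₁ ∖ R.  In
-- the sparse case we label stage by stage: P k, such a vertex for R the vertices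
-- seen so far, gets label k and its finitely many out-neighbours are blocked;
-- label -1-k goes to the k-th vertex of an enumeration of V (or to a fresh vertex
-- outside V₁ if that one is already labelled).  Then no edge climbs between
-- nonnegative labels, while every increasing path eventually reaches them.

_∖ₗ_ : {A : Set} → Pred A 0ℓ → List A → Pred A 0ℓ
S ∖ₗ R = S ∖ (_∈ R)

list-finite : {A : Set} (xs : List A) → Finite (_∈ xs)
list-finite xs = xs , λ _ x∈xs → x∈xs

-- A set on which some size measure h is unbounded is infinite: a covering list
-- would bound h by the maximum of its values.
unbounded⇒infinite : {A : Set} {S : Pred A 0ℓ} (h : A → ℕ) →
  (∀ n → Σ A λ a → S a × n ℕ.< h a) → Infinite S
unbounded⇒infinite {A} h unbounded (xs , cover) = ℕP.<⇒≱ bound<ha ha≤bound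
  where
  bound : ℕ
  bound = max 0 (map h xs)
  a : A
  a = proj₁ (unbounded bound)
  bound<ha : bound ℕ.< h a
  bound<ha = proj₂ (proj₂ (unbounded bound))
  ha≤bound : h a ℕ.≤ bound
  ha≤bound = lookup (xs≤max 0 (map h xs)) (∈-map⁺ h (cover a (proj₁ (proj₂ (unbounded bound)))))

module _ {A B : Set} (φ : A ⤖ B) {T : Pred B 0ℓ} where
  open Inverse (⤖⇒↔ φ) using (to; from; strictlyInverseˡ; strictlyInverseʳ)

  preimage-finite : Finite T → Finite (T ∘ to)
  preimage-finite (ys , cover) = map from ys , λ a Ta →
    subst (_∈ map from ys) (strictlyInverseʳ a) (∈-map⁺ from (cover (to a) Ta))

  preimage-infinite : Infinite T → Infinite (T ∘ to)
  preimage-infinite T-infinite (xs , cover) = T-infinite (map to xs , cover-T)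
    where
    cover-T : ∀ b → T b → b ∈ map to xs
    cover-T b Tb = subst (_∈ map to xs) (strictlyInverseˡ b)
      (∈-map⁺ to (cover (from b) (subst T (sym (strictlyInverseˡ b)) Tb)))

interval-finite : ∀ c → Finite (λ z → 0ℤ ≤ z × z ≤ c)
interval-finite c = map +_ (upTo (suc ℤ.∣ c ∣)) , cover
  where
  below-abs : ∀ {m c} → + m ≤ c → m ℕ.≤ ℤ.∣ c ∣
  below-abs (+≤+ m≤n) = m≤n
  cover : ∀ z → 0ℤ ≤ z × z ≤ c → z ∈ map +_ (upTo (suc ℤ.∣ c ∣))
  cover (+ m) (_ , m≤c) = ∈-map⁺ +_ (∈-upTo⁺ (s≤s (below-abs m≤c)))

nonnegative-infinite : Infinite (λ z → 0ℤ ≤ z)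
nonnegative-infinite = unbounded⇒infinite ℤ.∣_∣ λ n → + suc n , +≤+ ℕ.z≤n , ℕP.≤-refl

negative-infinite : Infinite (λ z → ¬ 0ℤ ≤ z)
negative-infinite = unbounded⇒infinite ℤ.∣_∣ λ n → -[1+ n ] , (λ ()) , ℕP.≤-refl

nonnegative-<-abs : ∀ {x y} → 0ℤ ≤ x → x < y → ℤ.∣ x ∣ ℕ.< ℤ.∣ y ∣
nonnegative-<-abs (+≤+ _) (+<+ m<n) = m<n

growing-mono : {A : Set} (L : ℕ → List A) → (∀ k → L k ⊆ L (suc k)) →
  ∀ {i j} → i ℕ.≤ j → L i ⊆ L j
growing-mono L grows i≤j = along (ℕP.≤⇒≤′ i≤j)
  where
  along : ∀ {i j} → i ≤′ j → L i ⊆ L j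
  along ≤′-refl = λ x∈ → x∈
  along (≤′-step i≤′j) = grows _ ∘ along i≤′j

Increasing : (ℕ → ℤ) → Set
Increasing a = ∀ i → a i < a (suc i)

module _ {a : ℕ → ℤ} (increasing : Increasing a) where

  increasing-monotone : ∀ {i j} → i ℕ.< j → a i < a j
  increasing-monotone i<j = along (ℕP.≤⇒≤′ i<j)
    where
    along : ∀ {i j} → suc i ≤′ j → a i < a j
    along ≤′-refl = increasing _
    along (≤′-step i<′j) = ℤP.<-trans (along i<′j) (increasing _)

  increasing-injective : Injective _≡_ _≡_ a
  increasing-injective {i} {j} eq with ℕP.<-cmp i j
  ... | tri< i<j _ _ = ⊥-elim (ℤP.<-irrefl eq (increasing-monotone i<j))
  ... | tri≈ _ i≡j _ = i≡j
  ... | tri> _ _ j<i = ⊥-elim (ℤP.<-irrefl (sym eq) (increasing-monotone j<i))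

  -- The sequence climbs by at least one per step, so from a i ≥ -1-m it is
  -- nonnegative within m+1 further steps.
  increasing-reaches-nonnegative : ∃ λ j → 0ℤ ≤ a j
  increasing-reaches-nonnegative = climb ℤ.∣ a 0 ∣ 0 (above (a 0))
    where
    above : ∀ z → -[1+ ℤ.∣ z ∣ ] ≤ z
    above (+ n) = -≤+
    above -[1+ n ] = -≤- (ℕP.n≤1+n n)
    climb : ∀ m i → -[1+ m ] ≤ a i → ∃ λ j → 0ℤ ≤ a j
    climb zero i bound = suc i , ℤP.i<j⇒suc[i]≤j (ℤP.≤-<-trans bound (increasing i))
    climb (suc m) i bound = climb m (suc i) (ℤP.i<j⇒suc[i]≤j (ℤP.≤-<-trans bound (increasing i)))

module Classical (lem : ExcludedMiddle 0ℓ) where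

  infinite-minus-finite : {A : Set} {S T : Pred A 0ℓ} → Infinite S → Finite T → Infinite (S ∖ T)
  infinite-minus-finite {S = S} {T} S-infinite (ys , cover-T) (xs , cover) =
    S-infinite (xs ++ ys , cover-S)
    where
    cover-S : ∀ a → S a → a ∈ xs ++ ys
    cover-S a Sa with lem {T a}
    ... | yes Ta = ∈-++⁺ʳ xs (cover-T a Ta)
    ... | no ¬Ta = ∈-++⁺ˡ (cover a (Sa , ¬Ta))

  infinite-nonempty : {A : Set} {S : Pred A 0ℓ} → Infinite S → Nonempty S
  infinite-nonempty {S = S} S-infinite with lem {Nonempty S}
  ... | yes nonempty = nonempty
  ... | no empty = ⊥-elim (S-infinite ([] , λ a Sa → ⊥-elim (empty (a , Sa))))

  avoid : {A : Set} {S : Pred A 0ℓ} → Infinite S → (xs : List A) → Nonempty (S ∖ₗ xs)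
  avoid S-infinite xs = infinite-nonempty (infinite-minus-finite S-infinite (list-finite xs))

  module _ (D : Digraph) where
    open Digraph D

    module _ (φ : Labeling D) where

      label : V → ℤ
      label = Bijection.to φ

      -- If all of W is labelled nonnegatively, a vertex w with infinite out-degree
      -- in D[W] has an out-neighbour in W of larger label: only finitely many
      -- vertices have labels in [0, label w].
      climbing-step : (W : Pred V 0ℓ) → (∀ v → W v → 0ℤ ≤ label v) →
        ∀ w → InfiniteOutDegreeIn D W w → Σ V λ u → W u × E w u × label w < label u
      climbing-step W nonnegative w infinite-degree
        with infinite-nonempty (infinite-minus-finite infinite-degree
                                  (preimage-finite φ (interval-finite (label w))))
      ... | u , (Wu , w→u) , not-below =
        u , Wu , w→u , ℤP.≰⇒> λ u≤w → not-below (nonnegative u Wu , u≤w)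

      dense-set-path : (W : Pred V 0ℓ) → Nonempty W → (∀ v → W v → 0ℤ ≤ label v) →
        (∀ v → W v → InfiniteOutDegreeIn D W v) → HasInfIncPath D φ
      dense-set-path W (w₀ , Ww₀) nonnegative dense =
        path , (λ eq → increasing-injective (proj₂ ∘ advances) (cong label eq)) , advances
        where
        step : (s : Σ V W) → Σ V λ u → W u × E (proj₁ s) u × label (proj₁ s) < label u
        step (w , Ww) = climbing-step W nonnegative w (dense w Ww)
        walk : ℕ → Σ V W
        walk zero = w₀ , Ww₀
        walk (suc i) = proj₁ (step (walk i)) , proj₁ (proj₂ (step (walk i)))
        path : ℕ → V
        path i = proj₁ (walk i)
        advances : ∀ i → E (path i) (path (suc i)) × label (path i) < label (path (suc i))
        advances i = proj₂ (proj₂ (step (walk i)))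

      UpwardEdgeFree : Set
      UpwardEdgeFree = ∀ {u v} → 0ℤ ≤ label u → label u < label v → ¬ E u v

      -- An increasing path reaches a nonnegative label, and its next edge climbs.
      no-increasing-path : UpwardEdgeFree → ¬ HasInfIncPath D φ
      no-increasing-path upward-free (p , _ , advances)
        with increasing-reaches-nonnegative (proj₂ ∘ advances)
      ... | j , 0≤pj = upward-free 0≤pj (proj₂ (advances j)) (proj₁ (advances j))

    condition1⇒condition2 : Condition1 D → Condition2 D
    condition1⇒condition2 condition1 φ
      with condition1 (λ v → 0ℤ ≤ label φ v)
             (preimage-infinite φ nonnegative-infinite) (preimage-infinite φ negative-infinite)
    ... | W , W-nonnegative , nonempty , dense =
      dense-set-path φ W nonempty (λ _ Wv → W-nonnegative Wv) dense

    Stuck : Pred V 0ℓ → List V → V → Set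
    Stuck V₁ R v = (V₁ ∖ₗ R) v × Finite (OutNbrsIn D (V₁ ∖ₗ R) v)

    Sparse : Pred V 0ℓ → Set
    Sparse V₁ = ∀ R → Σ V (Stuck V₁ R)

    dense-or-sparse : (V₁ : Pred V 0ℓ) → Sparse V₁ ⊎
      Σ (List V) λ R → ∀ v → (V₁ ∖ₗ R) v → InfiniteOutDegreeIn D (V₁ ∖ₗ R) v
    dense-or-sparse V₁ with lem {∃ λ R → ¬ Σ V (Stuck V₁ R)}
    ... | yes (R , none-stuck) = inj₂ (R , λ v v-free finite → none-stuck (v , v-free , finite))
    ... | no always-stuck = inj₁ stuck-vertex
      where
      stuck-vertex : Sparse V₁
      stuck-vertex R with lem {Σ V (Stuck V₁ R)}
      ... | yes stuck = stuck
      ... | no ¬stuck = ⊥-elim (always-stuck (R , ¬stuck))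

    -- For sparse V₁ with infinite complement, a labelling without infinite
    -- increasing path.
    module SparseLabelling (count : V ⤖ ℕ) (V₁ : Pred V 0ℓ)
                           (sparse : Sparse V₁) (co-infinite : Infinite (Compl V₁)) where

      enum : ℕ → V
      enum = Inverse.from (⤖⇒↔ count)

      enum-index : ∀ v → enum (Bijection.to count v) ≡ v
      enum-index = Inverse.strictlyInverseʳ (⤖⇒↔ count)

      -- Stage k: P k is stuck for R = blocked k and N k lists its out-neighbours
      -- in V₁ ∖ blocked k; Q k is enum k unless that is labelled already, then a
      -- fresh vertex outside V₁.  `labelled k` lists P i, Q i for i < k, and
      -- `blocked k` moreover the N i.
      blocked labelled : ℕ → List V
      P Q : ℕ → V
      N : ℕ → List V

      P k = proj₁ (sparse (blocked k))
      N k = proj₁ (proj₂ (proj₂ (sparse (blocked k))))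
      Q k with lem {enum k ∈ P k ∷ labelled k}
      ... | yes _ = proj₁ (avoid co-infinite (P k ∷ labelled k))
      ... | no _ = enum k

      blocked zero = []
      blocked (suc k) = P k ∷ Q k ∷ N k ++ blocked k
      labelled zero = []
      labelled (suc k) = P k ∷ Q k ∷ labelled k

      P-free : ∀ k → (V₁ ∖ₗ blocked k) (P k)
      P-free k = proj₁ (proj₂ (sparse (blocked k)))

      N-covers : ∀ k {u} → (V₁ ∖ₗ blocked k) u → E (P k) u → u ∈ N k
      N-covers k u-free edge = proj₂ (proj₂ (proj₂ (sparse (blocked k)))) _ (u-free , edge)

      Q-fresh : ∀ k → Q k ∉ P k ∷ labelled k
      Q-fresh k with lem {enum k ∈ P k ∷ labelled k}
      ... | yes _ = proj₂ (proj₂ (avoid co-infinite (P k ∷ labelled k)))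
      ... | no enum∉ = enum∉

      enum-labelled : ∀ k → enum k ∈ labelled (suc k)
      enum-labelled k with lem {enum k ∈ P k ∷ labelled k}
      ... | yes (here eq) = here eq
      ... | yes (there enum∈) = there (there enum∈)
      ... | no _ = there (here refl)

      labelled⊆blocked : ∀ k → labelled k ⊆ blocked k
      labelled⊆blocked (suc k) (here eq) = here eq
      labelled⊆blocked (suc k) (there (here eq)) = there (here eq)
      labelled⊆blocked (suc k) (there (there x∈)) =
        there (there (xs⊆ys++xs (blocked k) (N k) (labelled⊆blocked k x∈)))

      blocked-mono : ∀ {i j} → i ℕ.≤ j → blocked i ⊆ blocked j
      blocked-mono = growing-mono blocked λ k → there ∘ there ∘ xs⊆ys++xs (blocked k) (N k)

      labelled-mono : ∀ {i j} → i ℕ.≤ j → labelled i ⊆ labelled j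
      labelled-mono = growing-mono labelled λ _ → there ∘ there

      -- An edge P i → P j with i < j is impossible: P j was still free at stage i,
      -- so it was listed in N i and blocked from stage i+1 on.
      no-upward-P-edge : ∀ {i j} → i ℕ.< j → ¬ E (P i) (P j)
      no-upward-P-edge {i} {j} i<j edge =
        proj₂ (P-free j) (blocked-mono i<j (there (there (∈-++⁺ˡ (N-covers i free-at-i edge)))))
        where
        free-at-i : (V₁ ∖ₗ blocked i) (P j)
        free-at-i = proj₁ (P-free j) , proj₂ (P-free j) ∘ blocked-mono (ℕP.<⇒≤ i<j)

      ψ : ℤ → V
      ψ (+ k) = P k
      ψ -[1+ k ] = Q k

      stage : ℤ → ℕ
      stage (+ k) = k
      stage -[1+ k ] = k

      ψ-new : ∀ z → ψ z ∉ labelled (stage z)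
      ψ-new (+ k) = proj₂ (P-free k) ∘ labelled⊆blocked k
      ψ-new -[1+ k ] = Q-fresh k ∘ there

      ψ-recorded : ∀ z {j} → stage z ℕ.< j → ψ z ∈ labelled j
      ψ-recorded (+ k) k<j = labelled-mono k<j (here refl)
      ψ-recorded -[1+ k ] k<j = labelled-mono k<j (there (here refl))

      -- Different stages give different vertices since each is new at its stage;
      -- within a stage Q k differs from P k.
      ψ-injective : Injective _≡_ _≡_ ψ
      ψ-injective {a} {b} eq with ℕP.<-cmp (stage a) (stage b)
      ... | tri< a<b _ _ = ⊥-elim (ψ-new b (subst (_∈ labelled (stage b)) eq (ψ-recorded a a<b)))
      ... | tri> _ _ b<a = ⊥-elim (ψ-new a (subst (_∈ labelled (stage a)) (sym eq) (ψ-recorded b b<a)))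
      ... | tri≈ _ same _ = same-stage a b same eq
        where
        same-stage : ∀ a b → stage a ≡ stage b → ψ a ≡ ψ b → a ≡ b
        same-stage (+ k) (+ .k) refl _ = refl
        same-stage -[1+ k ] -[1+ .k ] refl _ = refl
        same-stage (+ k) -[1+ .k ] refl P≡Q = ⊥-elim (Q-fresh k (here (sym P≡Q)))
        same-stage -[1+ k ] (+ .k) refl Q≡P = ⊥-elim (Q-fresh k (here Q≡P))

      labelled-in-image : ∀ k {v} → v ∈ labelled k → ∃ λ z → ψ z ≡ v
      labelled-in-image (suc k) (here eq) = + k , sym eq
      labelled-in-image (suc k) (there (here eq)) = -[1+ k ] , sym eq
      labelled-in-image (suc k) (there (there v∈)) = labelled-in-image k v∈

      -- The vertex enum k is labelled by the end of stage k.
      ψ-surjective : ∀ v → ∃ λ z → ψ z ≡ v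
      ψ-surjective v = labelled-in-image (suc k)
        (subst (_∈ labelled (suc k)) (enum-index v) (enum-labelled k))
        where
        k : ℕ
        k = Bijection.to count v

      ψ-bijection : ℤ ⤖ V
      ψ-bijection = mk⤖ (ψ-injective , strictlySurjective⇒surjective ψ-surjective)

      labelling : Labeling D
      labelling = ↔⇒⤖ (↔-sym (⤖⇒↔ ψ-bijection))

      ψ-label : ∀ v → ψ (label labelling v) ≡ v
      ψ-label = Inverse.strictlyInverseˡ (⤖⇒↔ ψ-bijection)

      nonnegative-is-P : ∀ {v} → 0ℤ ≤ label labelling v → v ≡ P ℤ.∣ label labelling v ∣
      nonnegative-is-P {v} 0≤v =
        trans (sym (ψ-label v)) (cong ψ (sym (ℤP.0≤i⇒+∣i∣≡i 0≤v)))

      upward-edge-free : UpwardEdgeFree labelling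
      upward-edge-free 0≤u u<v edge = no-upward-P-edge (nonnegative-<-abs 0≤u u<v)
        (subst₂ E (nonnegative-is-P 0≤u) (nonnegative-is-P (ℤP.<⇒≤ (ℤP.≤-<-trans 0≤u u<v))) edge)

    condition2⇒condition1 : CountablyInfinite V → Condition2 D → Condition1 D
    condition2⇒condition1 count condition2 V₁ V₁-infinite co-infinite with dense-or-sparse V₁
    ... | inj₂ (R , dense) = V₁ ∖ₗ R , proj₁ , avoid V₁-infinite R , dense
    ... | inj₁ sparse = ⊥-elim (no-increasing-path labelling upward-edge-free (condition2 labelling))
      where
      open SparseLabelling count V₁ sparse co-infinite

proposition5p2 : ExcludedMiddle 0ℓ → (D : Digraph) → CountablyInfinite (Digraph.V D) →
    ((Condition1 D → Condition2 D) × (Condition2 D → Condition1 D))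
proposition5p2 lem D count = condition1⇒condition2 D , condition2⇒condition1 D count
  where
  open Classical lem
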